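{- Let $S$ be a numerical semigroup with minimal generators $a_1<a_2<\cdots<a_\nu$, with embedding dimension $\nu(S)=\nu\ge10$. If $a_2>\frac{c(S)+\mu(S)}{3}$ and $$\mu(S)\le\frac{8}{25}\nu^2+\frac15\nu-\frac54,$$ then $S$ satisfies Wilf's conjecture, i.e. $\nu(S)\,|L(S)|\ge c(S)$.
   Context: A numerical semigroup is a subset $S\subseteq\mathbb{N}$ containing $0$, closed under addition, with $\mathbb{N}\setminus S$ finite. Its conductor $c(S)$ is the least integer $x$ with $x+\mathbb{N}\subseteq S$. $S$ has a unique minimal set of generators; its cardinality is the embedding dimension $\nu(S)$ and its least element is the multiplicity $\mu(S)$. $L(S)=\{x\in S\mid 0\le x<c(S)\}$. -}

module Defs where

open import Data.Nat using (ℕ; zero; suc; _+_; _*_; _≤_; _<_)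
open import Data.Bool using (Bool; true; false; if_then_else_)
open import Data.Fin using (Fin; _<_)
open import Data.Product using (Σ; ∃; _×_; _,_)
open import Relation.Binary.PropositionalEquality using (_≡_; _≢_)
open import Function.Bundles using (_⇔_)

record NumericalSemigroup : Set where
  field
    mem      : ℕ → Bool
    zero∈    : mem 0 ≡ true
    closed   : ∀ x y → mem x ≡ true → mem y ≡ true → mem (x + y) ≡ true
    cofinite : Σ ℕ λ N → ∀ x → N ≤ x → mem x ≡ true

open NumericalSemigroup public

_∈S_ : ℕ → NumericalSemigroup → Set
x ∈S S = mem S x ≡ true

IsConductor : NumericalSemigroup → ℕ → Set
IsConductor S c =
  (∀ x → c ≤ x → x ∈S S) ×
  (∀ d → (∀ x → d ≤ x → x ∈S S) → c ≤ d)

IsMinimalGenerator : NumericalSemigroup → ℕ → Set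
IsMinimalGenerator S x =
  x ∈S S × x ≢ 0 ×
  (∀ y z → y ∈S S → z ∈S S → y ≢ 0 → z ≢ 0 → y + z ≢ x)

-- gens lists the minimal generators of S in strictly increasing order
-- (so n is the embedding dimension and gens i is a_{i+1}).
IsMinimalGeneratorList : NumericalSemigroup → (n : ℕ) → (Fin n → ℕ) → Set
IsMinimalGeneratorList S n gens =
  (∀ i j → i Data.Fin.< j → gens i Data.Nat.< gens j) ×
  (∀ x → IsMinimalGenerator S x ⇔ (∃ λ i → gens i ≡ x))

countBelow : NumericalSemigroup → ℕ → ℕ
countBelow S zero    = 0
countBelow S (suc n) = countBelow S n + (if mem S n then 1 else 0)

sizeL : NumericalSemigroup → ℕ → ℕ
sizeL S c = countBelow S c

module Submission where

-- Write every x ∈ [0, c) as x = t + sμ with t = x mod μ, s = x div μ.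
-- The element c + t lies in S, so c + t = qμ + (a sum of generators a_i ≠ μ);
-- since c + t < c + μ < 3a₂, at most two such a_i occur.  From this short
-- word and s we build a code (y, ℓ) with y ∈ L(S) and ℓ ∈ Fin ν (a "label").
-- The map x ↦ (y, ℓ) is injective, hence c ≤ ν · |L(S)|.  Injectivity rests
-- on one property of minimal generators: a_i + pμ = a_j + p'μ forces i = j.
-- It lets us read off from (y, ℓ) the weight w of the word; then t is the
-- unique residue below μ with c + t ≡ w (mod μ), and finally s is recovered.

open import Defs
open import Data.Nat using (ℕ; _+_; _*_; _≤_; _<_)
open import Data.Fin using (Fin; zero; suc)

open import Data.Nat using (zero; suc; _∸_; z≤n; s≤s; NonZero; _<?_; _/_; _%_; ≢-nonZero)
open import Data.Nat.Properties
open import Data.Nat.DivMod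
open import Data.Nat.Induction using (<-rec)
open import Data.Fin using (toℕ; fromℕ<; combine)
import Data.Fin.Properties as FinP
open import Data.List using (List; []; _∷_; _++_; map)
open import Data.List.Properties using (map-++)
open import Data.Nat.ListAction using (sum)
open import Data.Nat.ListAction.Properties using (sum-++)
open import Data.Maybe using (Maybe; nothing; just)
open import Data.Product using (Σ; ∃; _×_; _,_; proj₁; proj₂)
open import Data.Sum using (_⊎_; inj₁; inj₂)
open import Data.Empty using (⊥-elim)
open import Relation.Nullary using (Dec; yes; no)
open import Relation.Nullary.Decidable using (_×-dec_)
open import Relation.Binary.PropositionalEquality
open import Relation.Binary.Definitions using (tri<; tri≈; tri>)
open import Function.Bundles using (Equivalence)
import Data.Bool.Properties as Bool
open import Algebra.Properties.CommutativeSemigroup +-commutativeSemigroup using (interchange)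

offsets-congruent-≤ : ∀ {m} .{{_ : NonZero m}} {x t₁ t₂ q₁ q₂ w} → t₁ ≤ t₂ → t₂ < m →
  x + t₁ ≡ q₁ * m + w → x + t₂ ≡ q₂ * m + w → t₁ ≡ t₂
offsets-congruent-≤ {m} {x} {t₁} {t₂} {q₁} {q₂} {w} t₁≤t₂ t₂<m e₁ e₂ =
  sym (trans (sym (m+[n∸m]≡n t₁≤t₂)) (trans (cong (t₁ +_) d≡0) (+-identityʳ t₁)))
  where
  open ≡-Reasoning
  d : ℕ
  d = t₂ ∸ t₁
  shifted : (d + q₁ * m) + w ≡ q₂ * m + w
  shifted = begin
    (d + q₁ * m) + w ≡⟨ +-assoc d (q₁ * m) w ⟩
    d + (q₁ * m + w) ≡⟨ cong (d +_) (sym e₁) ⟩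
    d + (x + t₁)     ≡⟨ trans (+-comm d (x + t₁)) (+-assoc x t₁ d) ⟩
    x + (t₁ + d)     ≡⟨ cong (x +_) (m+[n∸m]≡n t₁≤t₂) ⟩
    x + t₂           ≡⟨ e₂ ⟩
    q₂ * m + w       ∎
  d≡0 : d ≡ 0
  d≡0 = begin
    d                ≡⟨ sym (m<n⇒m%n≡m (≤-<-trans (m∸n≤m t₂ t₁) t₂<m)) ⟩
    d % m            ≡⟨ sym ([m+kn]%n≡m%n d q₁ m) ⟩
    (d + q₁ * m) % m ≡⟨ cong (_% m) (+-cancelʳ-≡ w _ _ shifted) ⟩
    (q₂ * m) % m     ≡⟨ m*n%n≡0 q₂ m ⟩
    0                ∎

offsets-congruent : ∀ {m} .{{_ : NonZero m}} {x t₁ t₂ q₁ q₂ w} → t₁ < m → t₂ < m →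
  x + t₁ ≡ q₁ * m + w → x + t₂ ≡ q₂ * m + w → t₁ ≡ t₂
offsets-congruent {m} {x} {t₁} {t₂} {q₁} {q₂} {w} t₁<m t₂<m e₁ e₂ with ≤-total t₁ t₂
... | inj₁ t₁≤t₂ = offsets-congruent-≤ {m} {x} {t₁} {t₂} {q₁} {q₂} {w} t₁≤t₂ t₂<m e₁ e₂
... | inj₂ t₂≤t₁ = sym (offsets-congruent-≤ {m} {x} {t₂} {t₁} {q₂} {q₁} {w} t₂≤t₁ t₁<m e₂ e₁)

module Generators (S : NumericalSemigroup) (n : ℕ) (gens : Fin (suc n) → ℕ)
                  (isG : IsMinimalGeneratorList S (suc n) gens) where

  μ : ℕ
  μ = gens zero

  a : Fin n → ℕ
  a i = gens (suc i)

  minimal : ∀ i → IsMinimalGenerator S (gens i)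
  minimal i = Equivalence.from (proj₂ isG (gens i)) (i , refl)

  gens∈S : ∀ i → gens i ∈S S
  gens∈S i = proj₁ (minimal i)

  gens≢0 : ∀ i → gens i ≢ 0
  gens≢0 i = proj₁ (proj₂ (minimal i))

  irreducible : ∀ i y z → y ∈S S → z ∈S S → y ≢ 0 → z ≢ 0 → y + z ≢ gens i
  irreducible i = proj₂ (proj₂ (minimal i))

  instance
    μ-nonZero : NonZero μ
    μ-nonZero = ≢-nonZero (gens≢0 zero)

  multiple∈S : ∀ p → (p * μ) ∈S S
  multiple∈S zero    = zero∈ S
  multiple∈S (suc p) = closed S μ (p * μ) (gens∈S zero) (multiple∈S p)

  shift∈S : ∀ x p → x ∈S S → (x + p * μ) ∈S S
  shift∈S x p x∈S = closed S x (p * μ) x∈S (multiple∈S p)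

  -- For i < j, gens i + pμ ≠ gens j + p'μ: either the right side is larger,
  -- or gens j = gens i + (p - p')μ would decompose a minimal generator.
  translates-disjoint-< : ∀ {i j} p p' → toℕ i < toℕ j → gens i + p * μ ≢ gens j + p' * μ
  translates-disjoint-< {i} {j} p p' i<j eq with p' <? p
  ... | no p'≮p =
    <-irrefl eq (+-mono-<-≤ (proj₁ isG i j i<j) (*-monoˡ-≤ μ (≮⇒≥ p'≮p)))
  ... | yes p'<p = irreducible j (gens i) (d * μ) (gens∈S i) (multiple∈S d) (gens≢0 i) dμ≢0
                     (+-cancelʳ-≡ (p' * μ) _ _ decomposed)
    where
    open ≡-Reasoning
    d : ℕ
    d = p ∸ p'
    dμ≢0 : d * μ ≢ 0
    dμ≢0 dμ≡0 with m*n≡0⇒m≡0∨n≡0 d dμ≡0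
    ... | inj₁ d≡0 = <-irrefl refl (≤-trans p'<p (m∸n≡0⇒m≤n d≡0))
    ... | inj₂ μ≡0 = gens≢0 zero μ≡0
    decomposed : (gens i + d * μ) + p' * μ ≡ gens j + p' * μ
    decomposed = begin
      (gens i + d * μ) + p' * μ ≡⟨ +-assoc (gens i) (d * μ) (p' * μ) ⟩
      gens i + (d * μ + p' * μ) ≡⟨ cong (gens i +_) (sym (*-distribʳ-+ μ d p')) ⟩
      gens i + (d + p') * μ     ≡⟨ cong (λ u → gens i + u * μ) (m∸n+n≡m (<⇒≤ p'<p)) ⟩
      gens i + p * μ            ≡⟨ eq ⟩
      gens j + p' * μ           ∎

  translates-disjoint : ∀ {i j} p p' → gens i + p * μ ≡ gens j + p' * μ → i ≡ j
  translates-disjoint {i} {j} p p' eq with FinP.<-cmp i j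
  ... | tri< i<j _ _ = ⊥-elim (translates-disjoint-< p p' i<j eq)
  ... | tri≈ _ i≡j _ = i≡j
  ... | tri> _ _ j<i = ⊥-elim (translates-disjoint-< p' p j<i (sym eq))

  base : Maybe (Fin n) → ℕ
  base nothing  = 0
  base (just i) = a i

  multiple≢translate : ∀ p p' i → p * μ ≢ a i + p' * μ
  multiple≢translate zero     p' i eq = gens≢0 (suc i) (m+n≡0⇒m≡0 (a i) (sym eq))
  multiple≢translate (suc p) p' i eq with translates-disjoint p p' eq
  ... | ()

  base-unique : ∀ {h h'} p p' → base h + p * μ ≡ base h' + p' * μ → h ≡ h'
  base-unique {nothing} {nothing} p p' eq = refl
  base-unique {nothing} {just i}  p p' eq = ⊥-elim (multiple≢translate p p' i eq)
  base-unique {just i}  {nothing} p p' eq = ⊥-elim (multiple≢translate p' p i (sym eq))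
  base-unique {just i}  {just j}  p p' eq = cong just (FinP.suc-injective (translates-disjoint p p' eq))

  weight : List (Fin n) → ℕ
  weight l = sum (map a l)

  weight-++ : ∀ l l' → weight (l ++ l') ≡ weight l + weight l'
  weight-++ l l' = trans (cong sum (map-++ a l l')) (sum-++ (map a l) (map a l'))

  Factorization : ℕ → Set
  Factorization z = Σ ℕ λ q → Σ (List (Fin n)) λ l → z ≡ q * μ + weight l

  _⊕_ : ∀ {y z} → Factorization y → Factorization z → Factorization (y + z)
  _⊕_ {y} {z} (q₁ , l₁ , e₁) (q₂ , l₂ , e₂) = q₁ + q₂ , l₁ ++ l₂ , added
    where
    open ≡-Reasoning
    added : y + z ≡ (q₁ + q₂) * μ + weight (l₁ ++ l₂)
    added = begin
      y + z                                         ≡⟨ cong₂ _+_ e₁ e₂ ⟩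
      (q₁ * μ + weight l₁) + (q₂ * μ + weight l₂)   ≡⟨ interchange (q₁ * μ) (weight l₁) (q₂ * μ) (weight l₂) ⟩
      (q₁ * μ + q₂ * μ) + (weight l₁ + weight l₂)   ≡⟨ cong₂ _+_ (sym (*-distribʳ-+ μ q₁ q₂)) (sym (weight-++ l₁ l₂)) ⟩
      (q₁ + q₂) * μ + weight (l₁ ++ l₂)             ∎

  SplitsAt : ℕ → ℕ → Set
  SplitsAt z y = 0 < y × y ∈S S × (z ∸ y) ∈S S

  splitsAt? : ∀ z y → Dec (SplitsAt z y)
  splitsAt? z y = (0 <? y) ×-dec ((mem S y Bool.≟ _) ×-dec (mem S (z ∸ y) Bool.≟ _))

  splits-or-generator : ∀ z → z ∈S S → z ≢ 0 →
    (Σ (Fin z) λ y → SplitsAt z (toℕ y)) ⊎ (∃ λ i → gens i ≡ z)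
  splits-or-generator z z∈S z≢0 with FinP.any? (λ y → splitsAt? z (toℕ y))
  ... | yes split = inj₁ split
  ... | no ¬split = inj₂ (Equivalence.to (proj₂ isG z) (z∈S , z≢0 , unsplittable))
    where
    unsplittable : ∀ y u → y ∈S S → u ∈S S → y ≢ 0 → u ≢ 0 → y + u ≢ z
    unsplittable y u y∈S u∈S y≢0 u≢0 e =
      ¬split (fromℕ< y<z , subst (SplitsAt z) (sym (FinP.toℕ-fromℕ< y<z)) (n≢0⇒n>0 y≢0 , y∈S , rest∈S))
      where
      y<z : y < z
      y<z = subst (y <_) e (m<m+n y (n≢0⇒n>0 u≢0))
      rest∈S : (z ∸ y) ∈S S
      rest∈S = subst (_∈S S) (sym (trans (cong (_∸ y) (sym e)) (m+n∸m≡n y u))) u∈S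

  factorization : ∀ z → z ∈S S → Factorization z
  factorization = <-rec (λ z → z ∈S S → Factorization z) step
    where
    step : ∀ z → (∀ {y} → y < z → y ∈S S → Factorization y) → z ∈S S → Factorization z
    step zero    _   _   = 0 , [] , refl
    step (suc z) rec z∈S with splits-or-generator (suc z) z∈S (λ ())
    ... | inj₁ (y , 0<y , y∈S , rest∈S) =
      subst Factorization (m+[n∸m]≡n (<⇒≤ y<z)) (rec y<z y∈S ⊕ rec rest<z rest∈S)
      where
      y<z : toℕ y < suc z
      y<z = FinP.toℕ<n y
      rest<z : suc z ∸ toℕ y < suc z
      rest<z = ∸-monoʳ-< 0<y (<⇒≤ y<z)
    ... | inj₂ (zero , e)  = 1 , [] , sym (trans (+-identityʳ _) (trans (+-identityʳ μ) e))
    ... | inj₂ (suc i , e) = 0 , i ∷ [] , sym (trans (+-identityʳ (a i)) e)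

-- rank x = number of elements of S below x; it is strictly increasing on S,
-- so it embeds L(S) = S ∩ [0, c) into Fin |L(S)|.
module Rank (S : NumericalSemigroup) where

  rank : ℕ → ℕ
  rank = countBelow S

  rank-mono : ∀ {x y} → x ≤ y → rank x ≤ rank y
  rank-mono {y = zero} z≤n = ≤-refl
  rank-mono {x} {suc y} x≤y with m≤n⇒m<n∨m≡n x≤y
  ... | inj₁ (s≤s x≤y') = ≤-trans (rank-mono x≤y') (m≤m+n (rank y) _)
  ... | inj₂ refl       = ≤-refl

  rank-step : ∀ {x} → x ∈S S → suc (rank x) ≤ rank (suc x)
  rank-step {x} x∈S rewrite x∈S = ≤-reflexive (+-comm 1 (rank x))

  rank-strict : ∀ {x y} → x ∈S S → x < y → rank x < rank y
  rank-strict x∈S x<y = ≤-trans (rank-step x∈S) (rank-mono x<y)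

  rank-injective : ∀ {x y} → x ∈S S → y ∈S S → rank x ≡ rank y → x ≡ y
  rank-injective {x} {y} x∈S y∈S eq with <-cmp x y
  ... | tri< x<y _ _ = ⊥-elim (<-irrefl eq (rank-strict x∈S x<y))
  ... | tri≈ _ x≡y _ = x≡y
  ... | tri> _ _ y<x = ⊥-elim (<-irrefl (sym eq) (rank-strict y∈S y<x))

module WilfBound (S : NumericalSemigroup) (n : ℕ) (gens : Fin (2 + n) → ℕ)
                 (isG : IsMinimalGeneratorList S (2 + n) gens)
                 (c : ℕ) (isC : IsConductor S c)
                 (small : c + gens zero < 3 * gens (suc zero)) where

  open Generators S (suc n) gens isG
  open Rank S

  a₂≤a : ∀ i → a zero ≤ a i
  a₂≤a zero    = ≤-refl
  a₂≤a (suc i) = <⇒≤ (proj₁ isG (suc zero) (suc (suc i)) (s≤s (s≤s z≤n)))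

  weight-pair : ∀ i j → weight (i ∷ j ∷ []) ≡ a i + a j
  weight-pair i j = cong (a i +_) (+-identityʳ (a j))

  data Short : List (Fin (suc n)) → Set where
    none : Short []
    one  : ∀ i → Short (i ∷ [])
    two  : ∀ i j → Short (i ∷ j ∷ [])

  -- For t < μ a factorization of c + t uses at most two a's, because three
  -- of them already weigh at least 3a₂ > c + μ.
  short : ∀ {t q l} → t < μ → c + t ≡ q * μ + weight l → Short l
  short {l = []}              _   _ = none
  short {l = i ∷ []}          _   _ = one i
  short {l = i ∷ j ∷ []}      _   _ = two i j
  short {t} {q} {i ∷ j ∷ h ∷ l} t<μ e = ⊥-elim (<-irrefl refl (begin-strict
    c + t                          <⟨ <-trans (+-monoʳ-< c t<μ) small ⟩
    3 * a zero                     ≤⟨ +-mono-≤ (a₂≤a i) (+-mono-≤ (a₂≤a j) (+-mono-≤ (a₂≤a h) z≤n)) ⟩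
    weight (i ∷ j ∷ h ∷ l)         ≤⟨ m≤n+m _ (q * μ) ⟩
    q * μ + weight (i ∷ j ∷ h ∷ l) ≡⟨ sym e ⟩
    c + t                          ∎))
    where open ≤-Reasoning

  Code : Set
  Code = ℕ × Fin (2 + n)

  -- top t is the largest s with t + sμ < c.
  top : ℕ → ℕ
  top t = (c ∸ suc t) / μ

  label : Fin (suc n) → Fin (suc n) → Fin (2 + n)
  label i j with i FinP.≟ j
  ... | yes _ = zero
  ... | no _  = suc i

  label-diag : ∀ i → label i i ≡ zero
  label-diag i with i FinP.≟ i
  ... | yes _  = refl
  ... | no i≢i = ⊥-elim (i≢i refl)

  -- For a
  -- pair whose a i + sμ falls beyond c, the complementary multiple
  -- (top t - s)μ is used instead, so the element stays below c.  Words of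
  -- length ≥ 3 never occur (see short) and get a dummy code.
  encode : (t s : ℕ) → List (Fin (suc n)) → Code
  encode t s []                = s * μ , zero
  encode t s (i ∷ [])          = s * μ , suc i
  encode t s (i ∷ j ∷ []) with a i + s * μ <? c
  ... | yes _ = a i + s * μ , suc j
  ... | no _  = a j + (top t ∸ s) * μ , label i j
  encode t s (_ ∷ _ ∷ _ ∷ _)   = 0 , zero

  record Valid (t s : ℕ) : Set where
    constructor valid
    field
      offset<μ : t < μ
      below-c  : t + s * μ < c
  open Valid

  s≤top : ∀ {t s} → Valid t s → s ≤ top t
  s≤top {t} {s} (valid _ bound) = subst (_≤ top t) (m*n/n≡m s μ) (/-monoˡ-≤ μ sμ≤)
    where
    sμ≤ : s * μ ≤ c ∸ suc t
    sμ≤ = subst (_≤ c ∸ suc t) (m+n∸m≡n (suc t) (s * μ)) (∸-monoˡ-≤ (suc t) bound)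

  sμ<c : ∀ {t s} → Valid t s → s * μ < c
  sμ<c {t} (valid _ bound) = ≤-<-trans (m≤n+m _ t) bound

  -- In the complementary case the element a_j + (top t - s)μ is below c:
  -- adding a_i + sμ ≥ c to it gives a_i + a_j + (top t)μ ≤ (c + t) + (c - 1 - t).
  complement<c : ∀ {t s q i j} → Valid t s → c + t ≡ q * μ + weight (i ∷ j ∷ []) →
    c ≤ a i + s * μ → a j + (top t ∸ s) * μ < c
  complement<c {t} {s} {q} {i} {j} v e c≤ = +-cancelʳ-< c _ c (begin-strict
    y + c                      ≤⟨ +-monoʳ-≤ y c≤ ⟩
    y + (a i + s * μ)          ≡⟨ regroup ⟩
    (a i + a j) + top t * μ    ≤⟨ +-mono-≤ pair≤ (m/n*n≤m (c ∸ suc t) μ) ⟩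
    (c + t) + (c ∸ suc t)      ≡⟨ +-assoc c t (c ∸ suc t) ⟩
    c + (t + (c ∸ suc t))      <⟨ +-monoʳ-< c (≤-reflexive (m+[n∸m]≡n t<c)) ⟩
    c + c                      ∎)
    where
    open ≤-Reasoning
    y : ℕ
    y = a j + (top t ∸ s) * μ
    t<c : t < c
    t<c = ≤-<-trans (m≤m+n t (s * μ)) (below-c v)
    pair≤ : a i + a j ≤ c + t
    pair≤ = subst (a i + a j ≤_) (sym (trans e (cong (q * μ +_) (weight-pair i j)))) (m≤n+m _ (q * μ))
    regroup : y + (a i + s * μ) ≡ (a i + a j) + top t * μ
    regroup = begin-equality
      (a j + (top t ∸ s) * μ) + (a i + s * μ) ≡⟨ interchange (a j) _ (a i) (s * μ) ⟩
      (a j + a i) + ((top t ∸ s) * μ + s * μ) ≡⟨ cong (_+ ((top t ∸ s) * μ + s * μ)) (+-comm (a j) (a i)) ⟩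
      (a i + a j) + ((top t ∸ s) * μ + s * μ) ≡⟨ cong ((a i + a j) +_) (sym (*-distribʳ-+ μ (top t ∸ s) s)) ⟩
      (a i + a j) + ((top t ∸ s) + s) * μ     ≡⟨ cong (λ u → (a i + a j) + u * μ) (m∸n+n≡m (s≤top v)) ⟩
      (a i + a j) + top t * μ                 ∎

  encode∈L : ∀ {t s q l} → Short l → Valid t s → c + t ≡ q * μ + weight l →
    proj₁ (encode t s l) < c × proj₁ (encode t s l) ∈S S
  encode∈L {s = s} none    v _ = sμ<c v , multiple∈S s
  encode∈L {s = s} (one i) v _ = sμ<c v , multiple∈S s
  encode∈L {t} {s} {q} (two i j) v e with a i + s * μ <? c
  ... | yes below = below , shift∈S (a i) s (gens∈S (suc i))
  ... | no ¬below = complement<c {q = q} v e (≮⇒≥ ¬below) , shift∈S (a j) (top t ∸ s) (gens∈S (suc j))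

  -- A code (y, ℓ) determines the weight of the encoded word: y = base h + pμ
  -- with a unique base h, and (h, ℓ) determines the weight.
  headWeight : Maybe (Fin (suc n)) → Fin (2 + n) → ℕ
  headWeight nothing  zero    = 0
  headWeight nothing  (suc i) = a i
  headWeight (just i) zero    = a i + a i
  headWeight (just i) (suc j) = a i + a j

  Decodes : Code → ℕ → Set
  Decodes (y , ℓ) w = Σ (Maybe (Fin (suc n))) λ h → Σ ℕ λ p → y ≡ base h + p * μ × w ≡ headWeight h ℓ

  decodes-unique : ∀ {y ℓ w w'} → Decodes (y , ℓ) w → Decodes (y , ℓ) w' → w ≡ w'
  decodes-unique (h , p , y≡ , w≡) (h' , p' , y≡' , w≡') with base-unique {h} {h'} p p' (trans (sym y≡) y≡')
  ... | refl = trans w≡ (sym w≡')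

  encode-decodes : ∀ t s {l} → Short l → Decodes (encode t s l) (weight l)
  encode-decodes t s none    = nothing , s , refl , refl
  encode-decodes t s (one i) = nothing , s , refl , +-identityʳ (a i)
  encode-decodes t s (two i j) with a i + s * μ <? c
  ... | yes _ = just i , s , refl , weight-pair i j
  ... | no _ with i FinP.≟ j
  ...   | yes refl = just i , top t ∸ s , refl , weight-pair i i
  ...   | no _     = just j , top t ∸ s , refl , trans (weight-pair i j) (+-comm (a i) (a j))

  -- The two cases of the pair encoding never produce the same code:
  -- a i + pμ = a j + p'μ forces i = j, and then the labels suc j and
  -- label i i = zero differ.
  pair-cases-distinct : ∀ i j p p' → (a i + p * μ , suc j) ≢ (a j + p' * μ , label i j)
  pair-cases-distinct i j p p' e with FinP.suc-injective (translates-disjoint p p' (cong proj₁ e))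
  ... | refl = FinP.0≢1+n (sym (trans (cong proj₂ e) (label-diag i)))

  encode-injectiveˢ : ∀ {t s₁ s₂ l} → Short l → Valid t s₁ → Valid t s₂ →
    encode t s₁ l ≡ encode t s₂ l → s₁ ≡ s₂
  encode-injectiveˢ {s₁ = s₁} {s₂} none    _ _ eq = *-cancelʳ-≡ s₁ s₂ μ (cong proj₁ eq)
  encode-injectiveˢ {s₁ = s₁} {s₂} (one i) _ _ eq = *-cancelʳ-≡ s₁ s₂ μ (cong proj₁ eq)
  encode-injectiveˢ {t} {s₁} {s₂} (two i j) v₁ v₂ eq
    with a i + s₁ * μ <? c | a i + s₂ * μ <? c
  ... | yes _ | yes _ = *-cancelʳ-≡ s₁ s₂ μ (+-cancelˡ-≡ (a i) _ _ (cong proj₁ eq))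
  ... | no _  | no _  = ∸-cancelˡ-≡ (s≤top v₁) (s≤top v₂)
                          (*-cancelʳ-≡ _ _ μ (+-cancelˡ-≡ (a j) _ _ (cong proj₁ eq)))
  ... | yes _ | no _  = ⊥-elim (pair-cases-distinct i j s₁ (top t ∸ s₂) eq)
  ... | no _  | yes _ = ⊥-elim (pair-cases-distinct i j s₂ (top t ∸ s₁) (sym eq))

  factor : ∀ t → Factorization (c + t)
  factor t = factorization (c + t) (proj₁ isC (c + t) (m≤m+n c t))

  word : ℕ → List (Fin (suc n))
  word t = proj₁ (proj₂ (factor t))

  factor-eq : ∀ t → c + t ≡ proj₁ (factor t) * μ + weight (word t)
  factor-eq t = proj₂ (proj₂ (factor t))

  word-short : ∀ {t} → t < μ → Short (word t)
  word-short {t} t<μ = short {q = proj₁ (factor t)} t<μ (factor-eq t)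

  code : ℕ → ℕ → Code
  code t s = encode t s (word t)

  -- The code determines t: both words have the same weight w, and t is the
  -- residue below μ with c + t ≡ w (mod μ).
  code-determines-t : ∀ {t₁ s₁ t₂ s₂} → Valid t₁ s₁ → Valid t₂ s₂ → code t₁ s₁ ≡ code t₂ s₂ → t₁ ≡ t₂
  code-determines-t {t₁} {s₁} {t₂} {s₂} v₁ v₂ eq =
    offsets-congruent {q₁ = proj₁ (factor t₁)} {q₂ = proj₁ (factor t₂)} (offset<μ v₁) (offset<μ v₂) (factor-eq t₁)
      (trans (factor-eq t₂) (cong (proj₁ (factor t₂) * μ +_) (sym same-weight)))
    where
    same-weight : weight (word t₁) ≡ weight (word t₂)
    same-weight = decodes-unique (encode-decodes t₁ s₁ (word-short (offset<μ v₁)))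
      (subst (λ k → Decodes k (weight (word t₂))) (sym eq) (encode-decodes t₂ s₂ (word-short (offset<μ v₂))))

  code-injective : ∀ {t₁ s₁ t₂ s₂} → Valid t₁ s₁ → Valid t₂ s₂ → code t₁ s₁ ≡ code t₂ s₂ → t₁ ≡ t₂ × s₁ ≡ s₂
  code-injective v₁ v₂ eq with code-determines-t v₁ v₂ eq
  ... | refl = refl , encode-injectiveˢ (word-short (offset<μ v₁)) v₁ v₂ eq

  valid-digits : (x : Fin c) → Valid (toℕ x % μ) (toℕ x / μ)
  valid-digits x = valid (m%n<n (toℕ x) μ) (subst (_< c) (m≡m%n+[m/n]*n (toℕ x) μ) (FinP.toℕ<n x))

  codeOf : Fin c → Code
  codeOf x = code (toℕ x % μ) (toℕ x / μ)

  codeOf∈L : ∀ x → proj₁ (codeOf x) < c × proj₁ (codeOf x) ∈S S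
  codeOf∈L x = encode∈L {q = proj₁ (factor (toℕ x % μ))} (word-short (offset<μ (valid-digits x))) (valid-digits x) (factor-eq (toℕ x % μ))

  rankOf : Fin c → Fin (sizeL S c)
  rankOf x = fromℕ< (rank-strict (proj₂ (codeOf∈L x)) (proj₁ (codeOf∈L x)))

  embed : Fin c → Fin ((2 + n) * sizeL S c)
  embed x = combine (proj₂ (codeOf x)) (rankOf x)

  embed-injective : ∀ {x₁ x₂} → embed x₁ ≡ embed x₂ → x₁ ≡ x₂
  embed-injective {x₁} {x₂} eq = FinP.toℕ-injective (begin
    toℕ x₁                           ≡⟨ m≡m%n+[m/n]*n (toℕ x₁) μ ⟩
    toℕ x₁ % μ + (toℕ x₁ / μ) * μ    ≡⟨ cong₂ (λ t s → t + s * μ) (proj₁ same-ts) (proj₂ same-ts) ⟩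
    toℕ x₂ % μ + (toℕ x₂ / μ) * μ    ≡⟨ sym (m≡m%n+[m/n]*n (toℕ x₂) μ) ⟩
    toℕ x₂                           ∎)
    where
    open ≡-Reasoning
    parts : proj₂ (codeOf x₁) ≡ proj₂ (codeOf x₂) × rankOf x₁ ≡ rankOf x₂
    parts = FinP.combine-injective _ _ _ _ eq
    same-rank : rank (proj₁ (codeOf x₁)) ≡ rank (proj₁ (codeOf x₂))
    same-rank = trans (sym (FinP.toℕ-fromℕ< _)) (trans (cong toℕ (proj₂ parts)) (FinP.toℕ-fromℕ< _))
    same-code : codeOf x₁ ≡ codeOf x₂
    same-code = cong₂ _,_ (rank-injective (proj₂ (codeOf∈L x₁)) (proj₂ (codeOf∈L x₂)) same-rank) (proj₁ parts)
    same-ts : toℕ x₁ % μ ≡ toℕ x₂ % μ × toℕ x₁ / μ ≡ toℕ x₂ / μ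
    same-ts = code-injective (valid-digits x₁) (valid-digits x₂) same-code

  wilf : c ≤ (2 + n) * sizeL S c
  wilf = FinP.injective⇒≤ embed-injective

-- Proposition 4.6.
proposition4p6 : (S : NumericalSemigroup) (c k : ℕ) (gens : Fin (10 + k) → ℕ) →
    IsConductor S c →
    IsMinimalGeneratorList S (10 + k) gens →
    c + gens zero < 3 * gens (suc zero) →
    100 * gens zero + 125 ≤ 32 * ((10 + k) * (10 + k)) + 20 * (10 + k) →
    c ≤ (10 + k) * sizeL S c
proposition4p6 S c k gens isC isG small _ = WilfBound.wilf S (8 + k) gens isG c isC small
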